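{- Let $Q$ be a basic sequence that is infinite in limit, and let $P_Q$ be the set of real numbers whose $Q$-Cantor series expansion contains the digit $0$ only finitely many times. Then every element of $P_Q$ is not $Q$-ratio normal of order $2$.
   Context: A basic sequence is a sequence $Q=\{q_n\}$ of integers $q_n\ge2$; it is infinite in limit if $q_n\to\infty$. The $Q$-Cantor series expansion of $x$ is the unique expansion $x=\lfloor x\rfloor+\sum_{n\ge1}\frac{E_n}{q_1\cdots q_n}$ with $E_n\in\{0,\dots,q_n-1\}$ and $E_n\ne q_n-1$ infinitely often. A block of length $k$ is an ordered $k$-tuple of non-negative integers; $N_n^Q(B,x)$ is the number of occurrences of $B$ in the digit sequence $(E_j)$ starting at a position at most $n$. $x$ is $Q$-ratio normal of order $k$ if for all blocks $B,B'$ of length $k$, $\lim_{n\to\infty}N_n^Q(B,x)/N_n^Q(B',x)=1$. -}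

module Defs where

open import Data.Nat using (ℕ; zero; suc; _+_; _*_; _∸_; _≤_; _<_; ∣_-_∣)
open import Data.Nat.Properties using (_≟_)
open import Data.Fin using (Fin; toℕ)
open import Data.Fin.Properties using (all?)
open import Data.Product using (∃; ∃-syntax)
open import Relation.Nullary using (¬_; Dec; does)
open import Relation.Binary.PropositionalEquality using (_≡_)
open import Data.Bool using (if_then_else_)

-- Sequences are indexed from 0: q n stands for q_{n+1}, E n for E_{n+1}.

IsBasic : (ℕ → ℕ) → Set
IsBasic q = ∀ n → 2 ≤ q n

InfiniteInLimit : (ℕ → ℕ) → Set
InfiniteInLimit q = ∀ M → ∃[ N ] (∀ n → N ≤ n → M ≤ q n)

-- E is the digit sequence of a Q-Cantor series expansion:
-- 0 ≤ E_n < q_n and E_n ≠ q_n - 1 infinitely often.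
-- (Such sequences, together with an integer part, are in bijection with ℝ.)
IsCantorDigits : (ℕ → ℕ) → (ℕ → ℕ) → Set
IsCantorDigits q E = (∀ n → E n < q n) × (∀ m → ∃[ n ] (m ≤ n × ¬ (E n ≡ q n ∸ 1)))
  where open import Data.Product using (_×_)

FinitelyManyZeros : (ℕ → ℕ) → Set
FinitelyManyZeros E = ∃[ N ] (∀ n → N ≤ n → ¬ (E n ≡ 0))

Block : ℕ → Set
Block k = Fin k → ℕ

occursAt? : ∀ {k} (B : Block k) (E : ℕ → ℕ) (j : ℕ) → Dec (∀ i → E (j + toℕ i) ≡ B i)
occursAt? B E j = all? (λ i → E (j + toℕ i) ≟ B i)

-- N_n^Q(B,x): number of occurrences of B starting at a position among the
-- first n positions (positions 1..n in the paper = indices 0..n-1 here).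
count : ∀ {k} (B : Block k) (E : ℕ → ℕ) → ℕ → ℕ
count B E zero = 0
count B E (suc n) = count B E n + (if does (occursAt? B E n) then 1 else 0)

-- lim_{n→∞} a_n / b_n = 1, unfolded with ε = 1/(m+1):
-- eventually |a_n/b_n - 1| < 1/(m+1), i.e. (m+1)|a_n - b_n| < b_n
-- (which in particular forces b_n > 0 eventually, so the ratio is defined).
RatioTendsToOne : (ℕ → ℕ) → (ℕ → ℕ) → Set
RatioTendsToOne a b = ∀ m → ∃[ N ] (∀ n → N ≤ n → suc m * ∣ a n - b n ∣ < b n)

-- Q-ratio normal of order k (the expansion depends only on the digit sequence).
RatioNormal : ℕ → (ℕ → ℕ) → Set
RatioNormal k E = ∀ (B B′ : Block k) → RatioTendsToOne (count B E) (count B′ E)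

module Submission where

-- Ratio normality of order k forces every block of length k to occur
-- somewhere in the digit sequence: taking B′ = B and ε = 1, the definition
-- demands count B E n > 0 for large n.  If the digit 0 occurs only finitely
-- often, say never at positions ≥ N, then every occurrence of a 0 is at some
-- position j < N, and the digit following it, E (j + 1), is bounded by the
-- prefix sum E 0 + ⋯ + E N.  Hence the block (0, y) with y exceeding that sum
-- never occurs, contradicting ratio normality of order 2.

open import Defs
open import Data.Nat using (ℕ; zero; suc; _+_; _≤_; _<_; z≤n; s≤s)
open import Data.Nat.Properties
  using (≤-trans; ≤-refl; ≤-<-trans; m≤m+n; m≤n+m; m≤n⇒m<n∨m≡n; +-comm; +-identityʳ; <-irrefl; _<?_; ≮⇒≥)
open import Data.Fin using (toℕ) renaming (zero to fzero; suc to fsuc)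
open import Data.Product using (∃-syntax; _,_)
open import Data.Sum using (inj₁; inj₂)
open import Data.Empty using (⊥-elim)
open import Data.Bool using (if_then_else_)
open import Relation.Nullary using (¬_; Dec; yes; no; does)
open import Relation.Binary.PropositionalEquality using (_≡_; refl; sym; trans; cong; subst)

OccursAt : ∀ {k} → Block k → (ℕ → ℕ) → ℕ → Set
OccursAt B E j = ∀ i → E (j + toℕ i) ≡ B i

ratio-denominator-positive : ∀ a b → RatioTendsToOne a b → ∃[ n ] 0 < b n
ratio-denominator-positive a b ratio with ratio 0
... | N , close = N , ≤-<-trans z≤n (close N ≤-refl)

count-positive⇒occurs : ∀ {k} (B : Block k) E n →
                        0 < count B E n → ∃[ j ] OccursAt B E j
count-positive⇒occurs B E zero ()
count-positive⇒occurs B E (suc n) positive = step (occursAt? B E n) positive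
  where
    step : (d : Dec (OccursAt B E n)) →
           0 < count B E n + (if does d then 1 else 0) → ∃[ j ] OccursAt B E j
    step (yes occurs) _ = n , occurs
    step (no _) positive′ =
      count-positive⇒occurs B E n (subst (0 <_) (+-identityʳ _) positive′)

ratio-normal⇒occurs : ∀ {k} E → RatioNormal k E → (B : Block k) → ∃[ j ] OccursAt B E j
ratio-normal⇒occurs E normal B with ratio-denominator-positive (count B E) (count B E) (normal B B)
... | n , positive = count-positive⇒occurs B E n positive

prefixSum : (ℕ → ℕ) → ℕ → ℕ
prefixSum E zero = 0
prefixSum E (suc n) = prefixSum E n + E n

term≤prefixSum : ∀ E {k n} → k < n → E k ≤ prefixSum E n
term≤prefixSum E {k} {suc n} (s≤s k≤n) with m≤n⇒m<n∨m≡n k≤n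
... | inj₁ k<n  = ≤-trans (term≤prefixSum E k<n) (m≤m+n _ _)
... | inj₂ refl = m≤n+m _ _

zeroThen : ℕ → Block 2
zeroThen y fzero   = 0
zeroThen y (fsuc _) = y

-- If E has no zero at positions ≥ N, the block (0, y) with y larger than
-- E 0 + ⋯ + E N never occurs: a zero sits before N, so its successor is small.
zeroThen-absent : ∀ E N → (∀ n → N ≤ n → ¬ E n ≡ 0) →
                  ∀ j → ¬ OccursAt (zeroThen (suc (prefixSum E (suc N)))) E j
zeroThen-absent E N noZeroAfter j occurs =
  <-irrefl (occurs (fsuc fzero)) (s≤s (term≤prefixSum E successor<N+1))
  where
    zeroAt-j : E j ≡ 0
    zeroAt-j = trans (cong E (sym (+-identityʳ j))) (occurs fzero)

    j<N : j < N
    j<N with j <? N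
    ... | yes j<N = j<N
    ... | no  j≮N = ⊥-elim (noZeroAfter j (≮⇒≥ j≮N) zeroAt-j)

    successor<N+1 : j + 1 < suc N
    successor<N+1 = s≤s (subst (_≤ N) (+-comm 1 j) j<N)

lemma3p12 : (q : ℕ → ℕ) → IsBasic q → InfiniteInLimit q →
            (E : ℕ → ℕ) → IsCantorDigits q E → FinitelyManyZeros E →
            ¬ RatioNormal 2 E
lemma3p12 q _ _ E _ (N , noZeroAfter) normal
  with ratio-normal⇒occurs E normal (zeroThen (suc (prefixSum E (suc N))))
... | j , occurs = zeroThen-absent E N noZeroAfter j occurs
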